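{- Let $q\geq 2$, $s,t\in\mathbb{Z}_q$ and $g:\mathbb{Z}_q\to\mathbb{C}$. Let $G=(V,E)$ be a finite graph with a fixed orientation $\overrightarrow{E}$, and define $$F^{(q)}(G;\mathbf{x})=\prod_{(u,v)\in\overrightarrow{E}}\;\sum_{b\in\mathbb{Z}_q}g(b)\,x_u^{t-sb}x_v^{b}\ \bmod (x_v^q-1:v\in V).$$ Let $S,T:\mathbb{Z}_q^V\to\mathbb{Z}_q^E$ be the linear maps $(S\mathbf{d})_e=d_v-sd_u$ and $(T\mathbf{d})_e=td_u$ for $e=(u,v)\in\overrightarrow{E}$, with transposes $S^\top,T^\top:\mathbb{Z}_q^E\to\mathbb{Z}_q^V$, and let $\mathbf{1}\in\mathbb{Z}_q^V$ be the all-one vector. If $\mathbf{a}\in\mathbb{Z}_q^V$ and $\mathbf{b}\in\mathbb{Z}_q^E$ satisfy $S^\top\mathbf{b}=\mathbf{a}-T^\top\mathbf{1}$, then $$[\mathbf{x}^{\mathbf{a}}]F^{(q)}(G;\mathbf{x})=\sum_{\mathbf{b}'\in\ker(S^\top)+\mathbf{b}}\ \prod_{e\in E}g(b'_e),$$ a complete coset weight enumerator of $\ker(S^\top)$. In particular the coefficient $[\mathbf{x}^{T^\top\mathbf{1}}]F^{(q)}(G;\mathbf{x})=\sum_{\mathbf{b}'\in\ker(S^\top)}\prod_{e\in E}g(b'_e)$ is an evaluation of the complete weight enumerator of $\ker(S^\top)$ (and of $\mathrm{im}(S)$).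
   Context: Exponents are read modulo $q$; $\mathbb{C}[\mathbf{x}]/(x_v^q-1:v\in V)$ has monomial basis $\mathbf{x}^{\mathbf{a}}=\prod_{v}x_v^{a_v}$, $\mathbf{a}\in\mathbb{Z}_q^V$ (exponents in $\{0,\ldots,q-1\}$), and $[\mathbf{x}^{\mathbf{a}}]$ denotes the coefficient of $\mathbf{x}^{\mathbf{a}}$. Explicitly $(S^\top\mathbf{b})_v=\sum_{e=(u,v)\in\overrightarrow{E}}b_e-s\sum_{e=(v,u)\in\overrightarrow{E}}b_e$ and $(T^\top\mathbf{b})_v=t\sum_{e=(v,u)\in\overrightarrow{E}}b_e$. The complete weight enumerator of a subset $\mathbf{P}\subseteq\mathbb{Z}_q^E$ is $\sum_{\mathbf{p}\in\mathbf{P}}\prod_{a\in\mathbb{Z}_q}x_a^{\#\{e:p_e=a\}}$; an evaluation of it means substituting complex values for the $x_a$ (here $x_a=g(a)$). -}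

module Defs where

open import Level using (Level)
open import Data.Nat as ℕ using (ℕ; zero; suc; NonZero)
open import Data.Nat.DivMod using (_mod_)
open import Data.Fin as F using (Fin; toℕ)
open import Data.Fin.Properties using (all?) renaming (_≟_ to _≟F_)
open import Data.List as L using (List; []; _∷_; allFin; concatMap; filter)
import Data.Vec.Functional as VF
open import Relation.Nullary using (does)
open import Data.Bool using (if_then_else_)
open import Algebra.Bundles using (CommutativeRing)

module ZMod (q : ℕ) .{{_ : NonZero q}} where
  Zq : Set
  Zq = Fin q

  infixl 6 _+q_ _-q_
  infixl 7 _*q_

  _+q_ : Zq → Zq → Zq
  a +q b = (toℕ a ℕ.+ toℕ b) mod q

  _*q_ : Zq → Zq → Zq
  a *q b = (toℕ a ℕ.* toℕ b) mod q

  -q_ : Zq → Zq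
  -q a = (q ℕ.∸ toℕ a) mod q

  _-q_ : Zq → Zq → Zq
  a -q b = a +q (-q b)

  0q 1q : Zq
  0q = 0 mod q
  1q = 1 mod q

  sumZ : List Zq → Zq
  sumZ = L.foldr _+q_ 0q

  allVecs : (k : ℕ) → List (Fin k → Zq)
  allVecs zero = (λ ()) ∷ []
  allVecs (suc k) = concatMap (λ x → L.map (λ f → x VF.∷ f) (allVecs k)) (allFin q)

-- Setup: commutative ring R (replacing ℂ), modulus q, graph on vertex set Fin n
-- with m oriented edges e = (src e , tgt e), parameters s t ∈ ℤ_q, weight g.
module Setup {c ℓ : Level} (R : CommutativeRing c ℓ) (q : ℕ) .{{_ : NonZero q}}
             (n m : ℕ) (src tgt : Fin m → Fin n) (s t : Fin q)
             (g : Fin q → CommutativeRing.Carrier R) where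
  open CommutativeRing R
  open ZMod q public

  sumR : List Carrier → Carrier
  sumR = L.foldr _+_ 0#

  prodR : List Carrier → Carrier
  prodR = L.foldr _*_ 1#

  ExpV : Set
  ExpV = Fin n → Zq

  VecE : Set
  VecE = Fin m → Zq

  -- Elements of ℂ[x]/(x_v^q - 1 : v ∈ V) (with ℂ replaced by R), in the
  -- monomial basis: coefficient of x^a for each a ∈ ℤ_q^V.
  Poly : Set c
  Poly = ExpV → Carrier

  coeff : ExpV → Poly → Carrier
  coeff a f = f a

  mono : ExpV → Poly
  mono a d = if does (all? (λ v → a v ≟F d v)) then 1# else 0#

  _⊕_ : Poly → Poly → Poly
  (f ⊕ h) d = f d + h d

  _·_ : Carrier → Poly → Poly
  (r · f) d = r * f d

  _⊗_ : Poly → Poly → Poly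
  (f ⊗ h) d = sumR (L.map (λ e → f e * h (λ v → d v -q e v)) (allVecs n))

  zeroP oneP : Poly
  zeroP _ = 0#
  oneP = mono (λ _ → 0q)

  edgeExp : Fin m → Zq → ExpV
  edgeExp e b w = (if does (w ≟F src e) then t -q s *q b else 0q)
               +q (if does (w ≟F tgt e) then b else 0q)

  edgeFactor : Fin m → Poly
  edgeFactor e = L.foldr (λ b acc → (g b · mono (edgeExp e b)) ⊕ acc) zeroP (allFin q)

  Fq : Poly
  Fq = L.foldr (λ e acc → edgeFactor e ⊗ acc) oneP (allFin m)

  Sᵀ : VecE → ExpV
  Sᵀ b v = sumZ (L.map (λ e → if does (tgt e ≟F v) then b e else 0q) (allFin m))
         -q s *q sumZ (L.map (λ e → if does (src e ≟F v) then b e else 0q) (allFin m))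

  Tᵀ : VecE → ExpV
  Tᵀ b v = t *q sumZ (L.map (λ e → if does (src e ≟F v) then b e else 0q) (allFin m))

  𝟏E : VecE
  𝟏E _ = 1q

  kerSᵀ : List VecE
  kerSᵀ = filter (λ k → all? (λ v → Sᵀ k v ≟F 0q)) (allVecs m)

  weight : VecE → Carrier
  weight b' = prodR (L.map (λ e → g (b' e)) (allFin m))

  cosetEnum : VecE → Carrier
  cosetEnum b = sumR (L.map (λ k → weight (λ e → k e +q b e)) kerSᵀ)

module Submission where

open import Defs
open import Level using (Level; 0ℓ)
open import Data.Bool using (Bool; true; false; if_then_else_; _∧_)
open import Data.Nat as ℕ using (ℕ; zero; suc; NonZero; _%_; _≤_)
import Data.Nat.Properties as ℕ
open import Data.Nat.DivMod using (_mod_; m%n<n; %-distribˡ-+; %-distribˡ-*; m<n⇒m%n≡m; n%n≡0)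
open import Data.Fin using (Fin; zero; suc; toℕ)
open import Data.Fin.Properties using (toℕ-injective; toℕ-fromℕ<; toℕ<n; all?; _≟_)
open import Data.List using (List; []; _∷_; map; foldr; _++_; concatMap; filter; allFin)
open import Data.List.Properties using (map-++; map-tabulate; map-∘; map-cong; foldr-map)
import Data.Vec.Functional as V
open import Data.Product using (_×_; _,_)
open import Function using (_∘_; id)
open import Function.Bundles using (_⇔_; mk⇔; module Equivalence)
open import Relation.Nullary using (Dec; does; _×-dec_)
open import Relation.Nullary.Decidable using (dec-true; does-⇔)
open import Relation.Unary using (Pred; Decidable)
open import Relation.Binary.Core using (_Preserves_⟶_)
open import Relation.Binary.PropositionalEquality as ≡ using (_≡_; _≗_; cong; cong₂)
import Relation.Binary.Reasoning.Setoid as SetoidReasoning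
open import Algebra.Bundles using (Semiring; Ring; CommutativeRing)

open Equivalence using (to; from)

-- Expanding the product over the edges, F is the sum, over all edge labellings k ∈ ℤ_q^E, of
-- ∏_e g(k_e) · x^(exponent k), where edge e = (u , v) labelled k_e contributes the exponent
-- t - s k_e at u and k_e at v, so that exponent k = Sᵀ k + Tᵀ 𝟏.  Hence [x^a] F is the total weight
-- of the labellings with Sᵀ k = a - Tᵀ 𝟏 = Sᵀ b, i.e. of the coset ker(Sᵀ) + b; substituting
-- k = k′ + b, which permutes ℤ_q^E, turns this sum into the coset weight enumerator.

-- ℤ_q is the image of the semiring ℕ under the surjective map x ↦ x mod q, which respects
-- + and *, so the ring laws are inherited from ℕ.
module ZModRing (q : ℕ) .{{_ : NonZero q}} where
  open ZMod q
  open import Algebra.Structures {A = Zq} _≡_ using (IsCommutativeRing)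
  open ≡ using (refl; sym; trans; isEquivalence)
  open ≡.≡-Reasoning

  toℕ-mod : ∀ x → toℕ (x mod q) ≡ x % q
  toℕ-mod x = toℕ-fromℕ< (m%n<n x q)

  mod-cong-% : ∀ {x y} → x % q ≡ y % q → x mod q ≡ y mod q
  mod-cong-% {x} {y} eq = toℕ-injective (trans (toℕ-mod x) (trans eq (sym (toℕ-mod y))))

  mod-toℕ : ∀ a → toℕ a mod q ≡ a
  mod-toℕ a = toℕ-injective (trans (toℕ-mod (toℕ a)) (m<n⇒m%n≡m (toℕ<n a)))

  mod-+ : ∀ x y → (x ℕ.+ y) mod q ≡ x mod q +q y mod q
  mod-+ x y = mod-cong-% (trans (%-distribˡ-+ x y q)
    (sym (cong₂ (λ u v → (u ℕ.+ v) % q) (toℕ-mod x) (toℕ-mod y))))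

  mod-* : ∀ x y → (x ℕ.* y) mod q ≡ (x mod q) *q (y mod q)
  mod-* x y = mod-cong-% (trans (%-distribˡ-* x y q)
    (sym (cong₂ (λ u v → (u ℕ.* v) % q) (toℕ-mod x) (toℕ-mod y))))

  +q-comm : ∀ a b → a +q b ≡ b +q a
  +q-comm a b = cong (_mod q) (ℕ.+-comm (toℕ a) (toℕ b))

  *q-comm : ∀ a b → a *q b ≡ b *q a
  *q-comm a b = cong (_mod q) (ℕ.*-comm (toℕ a) (toℕ b))

  +q-assoc : ∀ a b c → (a +q b) +q c ≡ a +q (b +q c)
  +q-assoc a b c = begin
    (a +q b) +q c                          ≡⟨ cong ((a +q b) +q_) (mod-toℕ c) ⟨
    (toℕ a ℕ.+ toℕ b) mod q +q toℕ c mod q ≡⟨ mod-+ (toℕ a ℕ.+ toℕ b) (toℕ c) ⟨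
    (toℕ a ℕ.+ toℕ b ℕ.+ toℕ c) mod q      ≡⟨ cong (_mod q) (ℕ.+-assoc (toℕ a) (toℕ b) (toℕ c)) ⟩
    (toℕ a ℕ.+ (toℕ b ℕ.+ toℕ c)) mod q    ≡⟨ mod-+ (toℕ a) (toℕ b ℕ.+ toℕ c) ⟩
    toℕ a mod q +q (b +q c)                ≡⟨ cong (_+q (b +q c)) (mod-toℕ a) ⟩
    a +q (b +q c)                          ∎

  *q-assoc : ∀ a b c → (a *q b) *q c ≡ a *q (b *q c)
  *q-assoc a b c = begin
    (a *q b) *q c                          ≡⟨ cong ((a *q b) *q_) (mod-toℕ c) ⟨
    (toℕ a ℕ.* toℕ b) mod q *q (toℕ c mod q)  ≡⟨ mod-* (toℕ a ℕ.* toℕ b) (toℕ c) ⟨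
    (toℕ a ℕ.* toℕ b ℕ.* toℕ c) mod q      ≡⟨ cong (_mod q) (ℕ.*-assoc (toℕ a) (toℕ b) (toℕ c)) ⟩
    (toℕ a ℕ.* (toℕ b ℕ.* toℕ c)) mod q    ≡⟨ mod-* (toℕ a) (toℕ b ℕ.* toℕ c) ⟩
    (toℕ a mod q) *q (b *q c)              ≡⟨ cong (_*q (b *q c)) (mod-toℕ a) ⟩
    a *q (b *q c)                          ∎

  *q-distribˡ-+q : ∀ a b c → a *q (b +q c) ≡ a *q b +q a *q c
  *q-distribˡ-+q a b c = begin
    a *q (b +q c)
      ≡⟨ cong (_*q (b +q c)) (mod-toℕ a) ⟨
    (toℕ a mod q) *q ((toℕ b ℕ.+ toℕ c) mod q)
      ≡⟨ mod-* (toℕ a) (toℕ b ℕ.+ toℕ c) ⟨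
    (toℕ a ℕ.* (toℕ b ℕ.+ toℕ c)) mod q
      ≡⟨ cong (_mod q) (ℕ.*-distribˡ-+ (toℕ a) (toℕ b) (toℕ c)) ⟩
    (toℕ a ℕ.* toℕ b ℕ.+ toℕ a ℕ.* toℕ c) mod q
      ≡⟨ mod-+ (toℕ a ℕ.* toℕ b) (toℕ a ℕ.* toℕ c) ⟩
    a *q b +q a *q c
      ∎

  +q-identityˡ : ∀ a → 0q +q a ≡ a
  +q-identityˡ a = begin
    0q +q a                ≡⟨ cong (0q +q_) (mod-toℕ a) ⟨
    0 mod q +q toℕ a mod q ≡⟨ mod-+ 0 (toℕ a) ⟨
    toℕ a mod q            ≡⟨ mod-toℕ a ⟩
    a                      ∎

  *q-identityˡ : ∀ a → 1q *q a ≡ a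
  *q-identityˡ a = begin
    1q *q a                ≡⟨ cong (1q *q_) (mod-toℕ a) ⟨
    1q *q (toℕ a mod q)    ≡⟨ mod-* 1 (toℕ a) ⟨
    (1 ℕ.* toℕ a) mod q    ≡⟨ cong (_mod q) (ℕ.*-identityˡ (toℕ a)) ⟩
    toℕ a mod q            ≡⟨ mod-toℕ a ⟩
    a                      ∎

  -q-inverseʳ : ∀ a → a +q (-q a) ≡ 0q
  -q-inverseʳ a = begin
    a +q (-q a)                         ≡⟨ cong (_+q (-q a)) (mod-toℕ a) ⟨
    toℕ a mod q +q (q ℕ.∸ toℕ a) mod q  ≡⟨ mod-+ (toℕ a) (q ℕ.∸ toℕ a) ⟨
    (toℕ a ℕ.+ (q ℕ.∸ toℕ a)) mod q     ≡⟨ cong (_mod q) (ℕ.m+[n∸m]≡n (ℕ.<⇒≤ (toℕ<n a))) ⟩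
    q mod q
      ≡⟨ mod-cong-% (trans (n%n≡0 q) (sym (m<n⇒m%n≡m (ℕ.>-nonZero⁻¹ q)))) ⟩
    0q                                  ∎

  +q-*q-isCommutativeRing : IsCommutativeRing _+q_ _*q_ -q_ 0q 1q
  +q-*q-isCommutativeRing = record
    { isRing = record
      { +-isAbelianGroup = record
        { isGroup = record
          { isMonoid = record
            { isSemigroup = record
              { isMagma = record { isEquivalence = isEquivalence ; ∙-cong = cong₂ _+q_ }
              ; assoc = +q-assoc }
            ; identity = +q-identityˡ , λ a → trans (+q-comm a 0q) (+q-identityˡ a) }
          ; inverse = (λ a → trans (+q-comm (-q a) a) (-q-inverseʳ a)) , -q-inverseʳ
          ; ⁻¹-cong = cong (λ a → -q a) }
        ; comm = +q-comm }
      ; *-cong = cong₂ _*q_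
      ; *-assoc = *q-assoc
      ; *-identity = *q-identityˡ , λ a → trans (*q-comm a 1q) (*q-identityˡ a)
      ; distrib = *q-distribˡ-+q , λ a b c → trans (*q-comm (b +q c) a)
          (trans (*q-distribˡ-+q a b c) (cong₂ _+q_ (*q-comm a b) (*q-comm a c))) }
    ; *-comm = *q-comm }

  +q-*q-commutativeRing : CommutativeRing 0ℓ 0ℓ
  +q-*q-commutativeRing = record { isCommutativeRing = +q-*q-isCommutativeRing }

  open import Algebra.Properties.Group (CommutativeRing.+-group +q-*q-commutativeRing)
    using (//-rightDividesˡ; //-rightDividesʳ)

  x+y≡z⇔x≡z-y : ∀ {x y z} → (x +q y ≡ z) ⇔ (x ≡ z -q y)
  x+y≡z⇔x≡z-y {x} {y} = mk⇔ (λ { refl → sym (//-rightDividesʳ y x) })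
                             (λ { refl → //-rightDividesˡ y _ })

  module _ {k : ℕ} where

    infixl 6 _⊞_ _⊟_

    _⊞_ _⊟_ : (Fin k → Zq) → (Fin k → Zq) → Fin k → Zq
    (f ⊞ h) i = f i +q h i
    (f ⊟ h) i = f i -q h i

    _≗?_ : (f h : Fin k → Zq) → Dec (f ≗ h)
    f ≗? h = all? (λ i → f i ≟ h i)

    ⊞-≗-⇔ : ∀ f h e → (f ⊞ h) ≗ e ⇔ f ≗ (e ⊟ h)
    ⊞-≗-⇔ f h e = mk⇔ (λ eq i → to x+y≡z⇔x≡z-y (eq i)) (λ eq i → from x+y≡z⇔x≡z-y (eq i))

module ListSum {c ℓ} (R : Semiring c ℓ) where
  open Semiring R hiding (zero)
  open import Algebra.Properties.CommutativeSemigroup +-commutativeSemigroup using (interchange)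
  open import Relation.Binary.Reasoning.Setoid setoid

  sum : List Carrier → Carrier
  sum = foldr _+_ 0#

  [_] : Bool → Carrier
  [ b ] = if b then 1# else 0#

  [∧] : ∀ a b → [ a ∧ b ] ≈ [ a ] * [ b ]
  [∧] true  b = sym (*-identityˡ [ b ])
  [∧] false b = sym (zeroˡ [ b ])

  *-[] : ∀ b x → x * [ b ] ≈ (if b then x else 0#)
  *-[] true  x = *-identityʳ x
  *-[] false x = zeroʳ x

  if-+ : ∀ b x y → (if b then x + y else 0#) ≈ (if b then x else 0#) + (if b then y else 0#)
  if-+ true  x y = refl
  if-+ false x y = sym (+-identityˡ 0#)

  sum-++ : ∀ xs ys → sum (xs ++ ys) ≈ sum xs + sum ys
  sum-++ []       ys = sym (+-identityˡ (sum ys))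
  sum-++ (x ∷ xs) ys = trans (+-congˡ (sum-++ xs ys)) (sym (+-assoc x (sum xs) (sum ys)))

  module _ {a} {A : Set a} where

    sum-map-cong : ∀ {f h : A → Carrier} → (∀ x → f x ≈ h x) → ∀ xs → sum (map f xs) ≈ sum (map h xs)
    sum-map-cong f≈h []       = refl
    sum-map-cong f≈h (x ∷ xs) = +-cong (f≈h x) (sum-map-cong f≈h xs)

    sum-map-0 : ∀ {f : A → Carrier} → (∀ x → f x ≈ 0#) → ∀ xs → sum (map f xs) ≈ 0#
    sum-map-0 f≈0 []       = refl
    sum-map-0 f≈0 (x ∷ xs) = trans (+-cong (f≈0 x) (sum-map-0 f≈0 xs)) (+-identityˡ 0#)

    sum-map-+ : ∀ (f h : A → Carrier) xs →
                sum (map (λ x → f x + h x) xs) ≈ sum (map f xs) + sum (map h xs)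
    sum-map-+ f h []       = sym (+-identityˡ 0#)
    sum-map-+ f h (x ∷ xs) = begin
      (f x + h x) + sum (map (λ x → f x + h x) xs)     ≈⟨ +-congˡ (sum-map-+ f h xs) ⟩
      (f x + h x) + (sum (map f xs) + sum (map h xs))  ≈⟨ interchange (f x) (h x) _ _ ⟩
      (f x + sum (map f xs)) + (h x + sum (map h xs))  ∎

    sum-map-*ˡ : ∀ r (f : A → Carrier) xs → sum (map (λ x → r * f x) xs) ≈ r * sum (map f xs)
    sum-map-*ˡ r f []       = sym (zeroʳ r)
    sum-map-*ˡ r f (x ∷ xs) = trans (+-congˡ (sum-map-*ˡ r f xs)) (sym (distribˡ r (f x) _))

    sum-filter : ∀ {p} {P : Pred A p} (P? : Decidable P) (f : A → Carrier) xs →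
                 sum (map f (filter P? xs)) ≈ sum (map (λ x → if does (P? x) then f x else 0#) xs)
    sum-filter P? f [] = refl
    sum-filter P? f (x ∷ xs) with does (P? x)
    ... | true  = +-congˡ (sum-filter P? f xs)
    ... | false = trans (sum-filter P? f xs) (sym (+-identityˡ _))

  module _ {a b} {A : Set a} {B : Set b} where

    sum-map-concatMap : ∀ (f : B → Carrier) (h : A → List B) xs →
                        sum (map f (concatMap h xs)) ≈ sum (map (λ x → sum (map f (h x))) xs)
    sum-map-concatMap f h []       = refl
    sum-map-concatMap f h (x ∷ xs) = begin
      sum (map f (h x ++ concatMap h xs))                 ≡⟨ cong sum (map-++ f (h x) (concatMap h xs)) ⟩
      sum (map f (h x) ++ map f (concatMap h xs))         ≈⟨ sum-++ (map f (h x)) _ ⟩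
      sum (map f (h x)) + sum (map f (concatMap h xs))    ≈⟨ +-congˡ (sum-map-concatMap f h xs) ⟩
      sum (map f (h x)) + sum (map (λ x → sum (map f (h x))) xs) ∎

    sum-map-comm : ∀ (f : A → B → Carrier) xs ys →
                   sum (map (λ x → sum (map (f x) ys)) xs) ≈ sum (map (λ y → sum (map (λ x → f x y) xs)) ys)
    sum-map-comm f []       ys = sym (sum-map-0 (λ _ → refl) ys)
    sum-map-comm f (x ∷ xs) ys = begin
      sum (map (f x) ys) + sum (map (λ x → sum (map (f x) ys)) xs)
        ≈⟨ +-congˡ (sum-map-comm f xs ys) ⟩
      sum (map (f x) ys) + sum (map (λ y → sum (map (λ x → f x y) xs)) ys)
        ≈⟨ sum-map-+ (f x) _ ys ⟨
      sum (map (λ y → f x y + sum (map (λ x → f x y) xs)) ys) ∎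

module RingSum {c ℓ} (R : Ring c ℓ) where
  open Ring R
  open ListSum semiring
  open import Algebra.Properties.CommutativeSemigroup +-commutativeSemigroup using (interchange)
  open import Algebra.Properties.AbelianGroup +-abelianGroup using (⁻¹-∙-comm)
  open import Relation.Binary.Reasoning.Setoid setoid

  [a+b]-r[c+d]≈[a-rc]+[b-rd] : ∀ a b c d r → (a + b) - r * (c + d) ≈ (a - r * c) + (b - r * d)
  [a+b]-r[c+d]≈[a-rc]+[b-rd] a b c d r = begin
    (a + b) - r * (c + d)               ≈⟨ +-congˡ (-‿cong (distribˡ r c d)) ⟩
    (a + b) + - (r * c + r * d)         ≈⟨ +-congˡ (⁻¹-∙-comm (r * c) (r * d)) ⟨
    (a + b) + (- (r * c) + - (r * d))   ≈⟨ interchange a b _ _ ⟩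
    (a - r * c) + (b - r * d)           ∎

  0-r0≈0 : ∀ r → 0# - r * 0# ≈ 0#
  0-r0≈0 r = trans (+-congˡ (trans (-‿cong (zeroʳ r)) ε⁻¹≈ε)) (+-identityʳ 0#)
    where open import Algebra.Properties.Group +-group using (ε⁻¹≈ε)

  module _ {a} {A : Set a} where

    sum-map-- : ∀ r (f h : A → Carrier) xs →
                sum (map f xs) - r * sum (map h xs) ≈ sum (map (λ x → f x - r * h x) xs)
    sum-map-- r f h []       = 0-r0≈0 r
    sum-map-- r f h (x ∷ xs) =
      trans ([a+b]-r[c+d]≈[a-rc]+[b-rd] (f x) _ (h x) _ r) (+-congˡ (sum-map-- r f h xs))

  if-- : ∀ b t r x → (if b then t - r * x else 0#) ≈ t * [ b ] - r * (if b then x else 0#)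
  if-- true  t r x = +-congʳ (sym (*-identityʳ t))
  if-- false t r x = sym (trans (+-congʳ (zeroʳ t)) (0-r0≈0 r))

allFin-suc : ∀ k → allFin (suc k) ≡ zero ∷ map suc (allFin k)
allFin-suc k = cong (zero ∷_) (≡.sym (map-tabulate id suc))

map-allFin-suc : ∀ {a} {A : Set a} {k} (h : Fin (suc k) → A) →
                 map h (allFin (suc k)) ≡ h zero ∷ map (h ∘ suc) (allFin k)
map-allFin-suc {k = k} h = ≡.trans (cong (map h) (allFin-suc k)) (cong (h zero ∷_) (≡.sym (map-∘ (allFin k))))

module VectorSum {c ℓ} (R : Semiring c ℓ) (q : ℕ) .{{_ : NonZero q}} where
  open Semiring R hiding (zero)
  open ListSum R
  open ZMod q
  open ZModRing q using (_⊞_; _⊟_; _≗?_; ⊞-≗-⇔)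
  open import Relation.Binary.Reasoning.Setoid setoid

  sum-allFin-[≟] : ∀ {k} (a : Fin k) (G : Fin k → Carrier) →
                   sum (map (λ x → [ does (a ≟ x) ] * G x) (allFin k)) ≈ G a
  sum-allFin-[≟] {suc k} a G = trans (reflexive (cong sum (map-allFin-suc (λ x → [ does (a ≟ x) ] * G x))))
                                     (sift a G)
    where
    sift : ∀ (a : Fin (suc k)) G →
           [ does (a ≟ zero) ] * G zero + sum (map (λ x → [ does (a ≟ suc x) ] * G (suc x)) (allFin k)) ≈ G a
    sift zero    G = trans (+-cong (*-identityˡ (G zero)) (sum-map-0 (λ x → zeroˡ (G (suc x))) (allFin k)))
                           (+-identityʳ (G zero))
    sift (suc a) G = trans (+-cong (zeroˡ (G zero)) (sum-allFin-[≟] a (G ∘ suc))) (+-identityˡ (G (suc a)))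

  [≗?]-⇔ : ∀ {k k′} (f h : Fin k → Zq) (f′ h′ : Fin k′ → Zq) →
           f ≗ h ⇔ f′ ≗ h′ → [ does (f ≗? h) ] ≡ [ does (f′ ≗? h′) ]
  [≗?]-⇔ f h f′ h′ f≗h⇔f′≗h′ = cong [_] (does-⇔ f≗h⇔f′≗h′ (f ≗? h) (f′ ≗? h′))

  sum-allVecs-suc : ∀ k (H : (Fin (suc k) → Zq) → Carrier) →
                    sum (map H (allVecs (suc k)))
                    ≈ sum (map (λ x → sum (map (λ f → H (x V.∷ f)) (allVecs k))) (allFin q))
  sum-allVecs-suc k H = trans (sum-map-concatMap H _ (allFin q))
    (sum-map-cong (λ x → reflexive (cong sum (≡.sym (map-∘ (allVecs k))))) (allFin q))

  sum-allVecs-[≗?] : ∀ k (a : Fin k → Zq) (F : (Fin k → Zq) → Carrier) → F Preserves _≗_ ⟶ _≈_ →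
                     sum (map (λ f → [ does (a ≗? f) ] * F f) (allVecs k)) ≈ F a
  sum-allVecs-[≗?] zero a F F-cong = begin
    [ does (a ≗? (λ ())) ] * F (λ ()) + 0#  ≈⟨ +-identityʳ _ ⟩
    [ does (a ≗? (λ ())) ] * F (λ ())       ≡⟨ cong (λ b → [ b ] * F (λ ())) (dec-true (a ≗? (λ ())) (λ ())) ⟩
    1# * F (λ ())                           ≈⟨ *-identityˡ _ ⟩
    F (λ ())                                ≈⟨ F-cong (λ ()) ⟩
    F a                                     ∎
  sum-allVecs-[≗?] (suc k) a F F-cong = begin
    sum (map (λ f → [ does (a ≗? f) ] * F f) (allVecs (suc k)))
      ≈⟨ sum-allVecs-suc k _ ⟩
    sum (map (λ x → sum (map (λ f → [ does (a ≗? (x V.∷ f)) ] * F (x V.∷ f)) (allVecs k))) (allFin q))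
      ≈⟨ sum-map-cong sift-tail (allFin q) ⟩
    sum (map (λ x → [ does (a zero ≟ x) ] * F (x V.∷ V.tail a)) (allFin q))
      ≈⟨ sum-allFin-[≟] (a zero) (λ x → F (x V.∷ V.tail a)) ⟩
    F (a zero V.∷ V.tail a)
      ≈⟨ F-cong (λ { zero → ≡.refl ; (suc i) → ≡.refl }) ⟩
    F a ∎
    where
    head-tail : ∀ x f → (a ≗ (x V.∷ f)) ⇔ (a zero ≡ x × V.tail a ≗ f)
    head-tail x f = mk⇔ (λ eq → eq zero , eq ∘ suc)
                        (λ { (eq₀ , eqₛ) zero → eq₀ ; (eq₀ , eqₛ) (suc i) → eqₛ i })

    sift-tail : ∀ x → sum (map (λ f → [ does (a ≗? (x V.∷ f)) ] * F (x V.∷ f)) (allVecs k))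
                      ≈ [ does (a zero ≟ x) ] * F (x V.∷ V.tail a)
    sift-tail x = begin
      sum (map (λ f → [ does (a ≗? (x V.∷ f)) ] * F (x V.∷ f)) (allVecs k))
        ≈⟨ sum-map-cong (λ f → *-congʳ (split f)) (allVecs k) ⟩
      sum (map (λ f → ([ does (a zero ≟ x) ] * [ does (V.tail a ≗? f) ]) * F (x V.∷ f)) (allVecs k))
        ≈⟨ sum-map-cong (λ f → *-assoc _ _ _) (allVecs k) ⟩
      sum (map (λ f → [ does (a zero ≟ x) ] * ([ does (V.tail a ≗? f) ] * F (x V.∷ f))) (allVecs k))
        ≈⟨ sum-map-*ˡ _ _ (allVecs k) ⟩
      [ does (a zero ≟ x) ] * sum (map (λ f → [ does (V.tail a ≗? f) ] * F (x V.∷ f)) (allVecs k))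
        ≈⟨ *-congˡ (sum-allVecs-[≗?] k (V.tail a) (λ f → F (x V.∷ f))
                     (λ eq → F-cong (λ { zero → ≡.refl ; (suc i) → eq i }))) ⟩
      [ does (a zero ≟ x) ] * F (x V.∷ V.tail a) ∎
      where
      split : ∀ f → [ does (a ≗? (x V.∷ f)) ] ≈ [ does (a zero ≟ x) ] * [ does (V.tail a ≗? f) ]
      split f = trans (reflexive (cong [_] (does-⇔ (head-tail x f) (a ≗? (x V.∷ f))
                                                   ((a zero ≟ x) ×-dec (V.tail a ≗? f)))))
                      ([∧] _ _)

  sum-allVecs-translate : ∀ k (H : (Fin k → Zq) → Carrier) → H Preserves _≗_ ⟶ _≈_ → ∀ b →
                          sum (map (λ f → H (f ⊞ b)) (allVecs k)) ≈ sum (map H (allVecs k))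
  sum-allVecs-translate k H H-cong b = begin
    sum (map (λ f → H (f ⊞ b)) L)
      ≈⟨ sum-map-cong (λ f → sym (sum-allVecs-[≗?] k (f ⊞ b) H H-cong)) L ⟩
    sum (map (λ f → sum (map (λ e → [ does ((f ⊞ b) ≗? e) ] * H e) L)) L)
      ≈⟨ sum-map-comm (λ f e → [ does ((f ⊞ b) ≗? e) ] * H e) L L ⟩
    sum (map (λ e → sum (map (λ f → [ does ((f ⊞ b) ≗? e) ] * H e) L)) L)
      ≈⟨ sum-map-cong (λ e → trans (sum-map-cong (λ f → *-congʳ (reflexive (moved e f))) L)
                                   (sum-allVecs-[≗?] k (e ⊟ b) (λ _ → H e) (λ _ → refl))) L ⟩
    sum (map H L) ∎
    where
    L = allVecs k
    moved : ∀ e f → [ does ((f ⊞ b) ≗? e) ] ≡ [ does ((e ⊟ b) ≗? f) ]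
    moved e f = [≗?]-⇔ (f ⊞ b) e (e ⊟ b) f (mk⇔ (λ eq i → ≡.sym (to (⊞-≗-⇔ f b e) eq i))
                                                      (λ eq → from (⊞-≗-⇔ f b e) (λ i → ≡.sym (eq i))))

module ZModSum (q : ℕ) .{{_ : NonZero q}} where
  open CommutativeRing (ZModRing.+q-*q-commutativeRing q) public
  open ListSum semiring public
  open RingSum ring public
  open import Algebra.Properties.CommutativeSemigroup +-commutativeSemigroup public using (xy∙z≈zy∙x)

≟-does-comm : ∀ {k} (i j : Fin k) → does (i ≟ j) ≡ does (j ≟ i)
≟-does-comm i j = does-⇔ (mk⇔ ≡.sym ≡.sym) (i ≟ j) (j ≟ i)

module GraphPolynomial {c ℓ} (R : CommutativeRing c ℓ) (q : ℕ) .{{_ : NonZero q}} (n : ℕ)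
                       (s t : Fin q) (g : Fin q → CommutativeRing.Carrier R) where
  open CommutativeRing R hiding (zero)
  open ListSum semiring
  open VectorSum semiring q
  open ZMod q
  open ZModRing q
  module ℤq = ZModSum q
  module ≈-Reasoning = SetoidReasoning setoid

  module Edges (m : ℕ) (src tgt : Fin m → Fin n) where
    open Setup R q n m src tgt s t g public
      using (ExpV; VecE; Poly; coeff; mono; _⊕_; _·_; _⊗_; zeroP; oneP; edgeExp; edgeFactor; Fq;
             Sᵀ; Tᵀ; 𝟏E; kerSᵀ; weight; cosetEnum)

    ⊗-congʳ : ∀ f {h h′} → (∀ d → h d ≈ h′ d) → ∀ d → (f ⊗ h) d ≈ (f ⊗ h′) d
    ⊗-congʳ f h≈h′ d = sum-map-cong (λ e → *-congˡ (h≈h′ _)) (allVecs n)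

    ⊕-⊗ : ∀ f h Q d → ((f ⊕ h) ⊗ Q) d ≈ (f ⊗ Q) d + (h ⊗ Q) d
    ⊕-⊗ f h Q d = trans (sum-map-cong (λ e → distribʳ _ (f e) (h e)) (allVecs n)) (sum-map-+ _ _ (allVecs n))

    ·-⊗ : ∀ r f Q d → ((r · f) ⊗ Q) d ≈ r * (f ⊗ Q) d
    ·-⊗ r f Q d = trans (sum-map-cong (λ e → *-assoc r (f e) _) (allVecs n)) (sum-map-*ˡ r _ (allVecs n))

    zeroP-⊗ : ∀ Q d → (zeroP ⊗ Q) d ≈ 0#
    zeroP-⊗ Q d = sum-map-0 (λ e → zeroˡ _) (allVecs n)

    mono-⊗ : ∀ a Q → Q Preserves _≗_ ⟶ _≈_ → ∀ d → (mono a ⊗ Q) d ≈ Q (d ⊟ a)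
    mono-⊗ a Q Q-cong d =
      sum-allVecs-[≗?] n a (λ e → Q (d ⊟ e)) (λ eq → Q-cong (λ i → cong (λ x → d i -q x) (eq i)))

    edgeFactor-⊗ : ∀ e Q → Q Preserves _≗_ ⟶ _≈_ → ∀ d →
                   (edgeFactor e ⊗ Q) d ≈ sum (map (λ x → g x * Q (d ⊟ edgeExp e x)) (allFin q))
    edgeFactor-⊗ e Q Q-cong d = go (allFin q)
      where
      go : ∀ xs → (foldr (λ x acc → (g x · mono (edgeExp e x)) ⊕ acc) zeroP xs ⊗ Q) d
                  ≈ sum (map (λ x → g x * Q (d ⊟ edgeExp e x)) xs)
      go []       = zeroP-⊗ Q d
      go (x ∷ xs) = trans (⊕-⊗ _ _ Q d)
        (+-cong (trans (·-⊗ (g x) _ Q d) (*-congˡ (mono-⊗ (edgeExp e x) Q Q-cong d))) (go xs))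

    exponent : VecE → ExpV
    exponent k w = sumZ (map (λ e → edgeExp e (k e) w) (allFin m))

    term : VecE → Poly
    term k d = weight k * mono (exponent k) d

    Fq-expanded : Poly
    Fq-expanded d = sum (map (λ k → term k d) (allVecs m))

    weight-cong : ∀ {k k′} → k ≗ k′ → weight k ≡ weight k′
    weight-cong eq = cong (foldr _*_ 1#) (map-cong (λ e → cong g (eq e)) (allFin m))

    exponent-cong : ∀ {k k′} → k ≗ k′ → exponent k ≗ exponent k′
    exponent-cong eq w = cong sumZ (map-cong (λ e → cong (λ x → edgeExp e x w) (eq e)) (allFin m))

    mono-cong : ∀ {a a′ d d′} → a ≗ a′ → d ≗ d′ → mono a d ≡ mono a′ d′
    mono-cong {a} {a′} {d} {d′} a≗a′ d≗d′ = [≗?]-⇔ a d a′ d′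
      (mk⇔ (λ eq i → ≡.trans (≡.sym (a≗a′ i)) (≡.trans (eq i) (d≗d′ i)))
           (λ eq i → ≡.trans (a≗a′ i) (≡.trans (eq i) (≡.sym (d≗d′ i)))))

    term-cong : ∀ d → (λ k → term k d) Preserves _≗_ ⟶ _≈_
    term-cong d eq = reflexive (cong₂ _*_ (weight-cong eq) (mono-cong (exponent-cong eq) (λ _ → ≡.refl)))

    Fq-expanded-cong : Fq-expanded Preserves _≗_ ⟶ _≈_
    Fq-expanded-cong eq =
      sum-map-cong (λ k → reflexive (cong (weight k *_) (mono-cong (λ _ → ≡.refl) eq))) (allVecs m)

    σ : Fin m → Fin n → Zq → Zq
    σ e w x = (if does (tgt e ≟ w) then x else 0q) -q s *q (if does (src e ≟ w) then x else 0q)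

    Sᵀ-as-sum : ∀ k w → Sᵀ k w ≡ ℤq.sum (map (λ e → σ e w (k e)) (allFin m))
    Sᵀ-as-sum k w = ℤq.sum-map-- s _ _ (allFin m)

    σ-+ : ∀ e w x y → σ e w (x +q y) ≡ σ e w x +q σ e w y
    σ-+ e w x y = ≡.trans (cong₂ (λ a b → a -q s *q b) (ℤq.if-+ _ x y) (ℤq.if-+ _ x y))
                          (ℤq.[a+b]-r[c+d]≈[a-rc]+[b-rd] _ _ _ _ s)

    edgeExp-as-σ : ∀ e x w → edgeExp e x w ≡ σ e w x +q t *q ℤq.[ does (src e ≟ w) ]
    edgeExp-as-σ e x w = begin
      edgeExp e x w
        ≡⟨ cong₂ (λ b b′ → (if b then t -q s *q x else 0q) +q (if b′ then x else 0q))
                 (≟-does-comm w (src e)) (≟-does-comm w (tgt e)) ⟩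
      (if does (src e ≟ w) then t -q s *q x else 0q) +q (if does (tgt e ≟ w) then x else 0q)
        ≡⟨ cong (_+q (if does (tgt e ≟ w) then x else 0q)) (ℤq.if-- _ t s x) ⟩
      (t *q ℤq.[ does (src e ≟ w) ] -q s *q (if does (src e ≟ w) then x else 0q))
        +q (if does (tgt e ≟ w) then x else 0q)
        ≡⟨ ℤq.xy∙z≈zy∙x _ _ _ ⟩
      σ e w x +q t *q ℤq.[ does (src e ≟ w) ] ∎
      where open ≡.≡-Reasoning

    exponent-as-Sᵀ : ∀ k w → exponent k w ≡ Sᵀ k w +q Tᵀ 𝟏E w
    exponent-as-Sᵀ k w = begin
      exponent k w
        ≡⟨ ℤq.sum-map-cong (λ e → edgeExp-as-σ e (k e) w) es ⟩
      ℤq.sum (map (λ e → σ e w (k e) +q t *q ℤq.[ does (src e ≟ w) ]) es)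
        ≡⟨ ℤq.sum-map-+ _ _ es ⟩
      ℤq.sum (map (λ e → σ e w (k e)) es) +q ℤq.sum (map (λ e → t *q ℤq.[ does (src e ≟ w) ]) es)
        ≡⟨ cong₂ _+q_ (≡.sym (Sᵀ-as-sum k w)) (ℤq.sum-map-*ˡ t _ es) ⟩
      Sᵀ k w +q Tᵀ 𝟏E w ∎
      where open ≡.≡-Reasoning
            es = allFin m

    Sᵀ-⊞ : ∀ k b w → Sᵀ (k ⊞ b) w ≡ Sᵀ k w +q Sᵀ b w
    Sᵀ-⊞ k b w = begin
      Sᵀ (k ⊞ b) w                                              ≡⟨ Sᵀ-as-sum (k ⊞ b) w ⟩
      ℤq.sum (map (λ e → σ e w (k e +q b e)) es)                ≡⟨ ℤq.sum-map-cong (λ e → σ-+ e w (k e) (b e)) es ⟩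
      ℤq.sum (map (λ e → σ e w (k e) +q σ e w (b e)) es)        ≡⟨ ℤq.sum-map-+ _ _ es ⟩
      ℤq.sum (map (λ e → σ e w (k e)) es) +q ℤq.sum (map (λ e → σ e w (b e)) es)
                                                                ≡⟨ cong₂ _+q_ (Sᵀ-as-sum k w) (Sᵀ-as-sum b w) ⟨
      Sᵀ k w +q Sᵀ b w                                          ∎
      where open ≡.≡-Reasoning
            es = allFin m

    Sᵀ-0 : ∀ w → Sᵀ (λ _ → 0q) w ≡ 0q
    Sᵀ-0 w = ≡.trans (cong₂ (λ a b → a -q s *q b) (ℤq.sum-map-0 (λ e → if-0 (does (tgt e ≟ w))) es)
                                                  (ℤq.sum-map-0 (λ e → if-0 (does (src e ≟ w))) es))
                     (ℤq.0-r0≈0 s)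
      where es = allFin m
            if-0 : ∀ b → (if b then 0q else 0q) ≡ 0q
            if-0 true  = ≡.refl
            if-0 false = ≡.refl

  module Successor (m : ℕ) (src tgt : Fin (suc m) → Fin n) where
    module G = Edges (suc m) src tgt
    module H = Edges m (src ∘ suc) (tgt ∘ suc)

    Fq-suc : ∀ d → G.Fq d ≡ (G.edgeFactor zero G.⊗ H.Fq) d
    Fq-suc d = cong (λ P → P d) (≡.trans (cong (foldr step G.oneP) (allFin-suc m))
                                         (cong (G.edgeFactor zero G.⊗_) (foldr-map step suc G.oneP (allFin m))))
      where step = λ e acc → G.edgeFactor e G.⊗ acc

    exponent-∷ : ∀ x f w → G.exponent (x V.∷ f) w ≡ G.edgeExp zero x w +q H.exponent f w
    exponent-∷ x f w = cong sumZ (map-allFin-suc (λ e → G.edgeExp e ((x V.∷ f) e) w))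

    weight-∷ : ∀ x f → G.weight (x V.∷ f) ≡ g x * H.weight f
    weight-∷ x f = cong (foldr _*_ 1#) (map-allFin-suc (λ e → g ((x V.∷ f) e)))

    mono-∷ : ∀ x f d → H.mono (H.exponent f) (d ⊟ G.edgeExp zero x) ≡ G.mono (G.exponent (x V.∷ f)) d
    mono-∷ x f d = [≗?]-⇔ (H.exponent f) (d ⊟ ε) (G.exponent (x V.∷ f)) d
      (mk⇔ (λ eq i → ≡.trans (exponent-∷ x f i) (shifted⇒ i (eq i)))
           (λ eq i → shifted⇐ i (≡.trans (≡.sym (exponent-∷ x f i)) (eq i))))
      where
      ε = G.edgeExp zero x
      shifted⇒ : ∀ i → H.exponent f i ≡ d i -q ε i → ε i +q H.exponent f i ≡ d i
      shifted⇒ i eq = ≡.trans (+q-comm (ε i) (H.exponent f i)) (from x+y≡z⇔x≡z-y eq)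
      shifted⇐ : ∀ i → ε i +q H.exponent f i ≡ d i → H.exponent f i ≡ d i -q ε i
      shifted⇐ i eq = to x+y≡z⇔x≡z-y (≡.trans (+q-comm (H.exponent f i) (ε i)) eq)

    prepend-edge : ∀ x d → g x * H.Fq-expanded (d ⊟ G.edgeExp zero x)
                           ≈ sum (map (λ f → G.term (x V.∷ f) d) (allVecs m))
    prepend-edge x d = trans (sym (sum-map-*ˡ (g x) _ (allVecs m))) (sum-map-cong (λ f → trans (sym (*-assoc _ _ _))
      (reflexive (cong₂ _*_ (≡.sym (weight-∷ x f)) (mono-∷ x f d)))) (allVecs m))

  Fq≈Fq-expanded : ∀ m (src tgt : Fin m → Fin n) d → Edges.Fq m src tgt d ≈ Edges.Fq-expanded m src tgt d
  Fq≈Fq-expanded zero    src tgt d = sym (trans (+-identityʳ _) (*-identityˡ _))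
  Fq≈Fq-expanded (suc m) src tgt d = begin
    G.Fq d                                   ≡⟨ Fq-suc d ⟩
    (G.edgeFactor zero G.⊗ H.Fq) d           ≈⟨ G.⊗-congʳ (G.edgeFactor zero) (Fq≈Fq-expanded m _ _) d ⟩
    (G.edgeFactor zero G.⊗ H.Fq-expanded) d  ≈⟨ G.edgeFactor-⊗ zero H.Fq-expanded H.Fq-expanded-cong d ⟩
    sum (map (λ x → g x * H.Fq-expanded (d ⊟ G.edgeExp zero x)) (allFin q))
                                             ≈⟨ sum-map-cong (λ x → prepend-edge x d) (allFin q) ⟩
    sum (map (λ x → sum (map (λ f → G.term (x V.∷ f) d) (allVecs m))) (allFin q))
                                             ≈⟨ sum-allVecs-suc m _ ⟨
    G.Fq-expanded d                          ∎
    where open Successor m src tgt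
          open ≈-Reasoning

  module Coefficients (m : ℕ) (src tgt : Fin m → Fin n) where
    open Edges m src tgt

    module _ (a : ExpV) (b : VecE) (Sᵀb≡a-Tᵀ𝟏 : ∀ v → Sᵀ b v ≡ a v -q Tᵀ 𝟏E v) where

      exponent-⊞ : ∀ k v → exponent (k ⊞ b) v ≡ Sᵀ k v +q a v
      exponent-⊞ k v = begin
        exponent (k ⊞ b) v                       ≡⟨ exponent-as-Sᵀ (k ⊞ b) v ⟩
        Sᵀ (k ⊞ b) v +q Tᵀ 𝟏E v                  ≡⟨ cong (_+q Tᵀ 𝟏E v) (Sᵀ-⊞ k b v) ⟩
        Sᵀ k v +q Sᵀ b v +q Tᵀ 𝟏E v              ≡⟨ cong (λ x → Sᵀ k v +q x +q Tᵀ 𝟏E v) (Sᵀb≡a-Tᵀ𝟏 v) ⟩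
        Sᵀ k v +q (a v -q Tᵀ 𝟏E v) +q Tᵀ 𝟏E v    ≡⟨ +q-assoc (Sᵀ k v) _ _ ⟩
        Sᵀ k v +q (a v -q Tᵀ 𝟏E v +q Tᵀ 𝟏E v)    ≡⟨ cong (Sᵀ k v +q_) (from x+y≡z⇔x≡z-y ≡.refl) ⟩
        Sᵀ k v +q a v                            ∎
        where open ≡.≡-Reasoning

      mono-⊞ : ∀ k → mono (exponent (k ⊞ b)) a ≡ [ does (Sᵀ k ≗? (λ _ → 0q)) ]
      mono-⊞ k = [≗?]-⇔ (exponent (k ⊞ b)) a (Sᵀ k) (λ _ → 0q) (mk⇔ in-kernel⇐ in-kernel⇒)
        where
        in-kernel⇐ : exponent (k ⊞ b) ≗ a → Sᵀ k ≗ (λ _ → 0q)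
        in-kernel⇐ eq v = ≡.trans (to x+y≡z⇔x≡z-y (≡.trans (≡.sym (exponent-⊞ k v)) (eq v)))
                                  (ℤq.-‿inverseʳ (a v))
        in-kernel⇒ : Sᵀ k ≗ (λ _ → 0q) → exponent (k ⊞ b) ≗ a
        in-kernel⇒ eq v = ≡.trans (exponent-⊞ k v)
                                  (from x+y≡z⇔x≡z-y (≡.trans (eq v) (≡.sym (ℤq.-‿inverseʳ (a v)))))

      coeff-Fq≈cosetEnum : coeff a Fq ≈ cosetEnum b
      coeff-Fq≈cosetEnum = begin
        Fq a                                            ≈⟨ Fq≈Fq-expanded m src tgt a ⟩
        Fq-expanded a                                   ≈⟨ sum-allVecs-translate m (λ k → term k a) (term-cong a) b ⟨
        sum (map (λ k → term (k ⊞ b) a) (allVecs m))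
          ≈⟨ sum-map-cong (λ k → trans (reflexive (cong (weight (k ⊞ b) *_) (mono-⊞ k))) (*-[] _ _))
                          (allVecs m) ⟩
        sum (map (λ k → if does (Sᵀ k ≗? (λ _ → 0q)) then weight (k ⊞ b) else 0#) (allVecs m))
          ≈⟨ sum-filter (λ k → Sᵀ k ≗? (λ _ → 0q)) (λ k → weight (k ⊞ b)) (allVecs m) ⟨
        cosetEnum b                                     ∎
        where open ≈-Reasoning

    coeff-Fq-Tᵀ𝟏≈weightEnum : coeff (Tᵀ 𝟏E) Fq ≈ sum (map weight kerSᵀ)
    coeff-Fq-Tᵀ𝟏≈weightEnum = trans
      (coeff-Fq≈cosetEnum (Tᵀ 𝟏E) (λ _ → 0q)
                          (λ v → ≡.trans (Sᵀ-0 v) (≡.sym (ℤq.-‿inverseʳ (Tᵀ 𝟏E v)))))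
      (sum-map-cong (λ k → reflexive (weight-cong (λ e → ℤq.+-identityʳ (k e)))) kerSᵀ)

theorem5 : {c ℓ : Level} (R : CommutativeRing c ℓ) (q : ℕ) .{{_ : NonZero q}} → 2 ≤ q →
    (n m : ℕ) (src tgt : Fin m → Fin n) (s t : Fin q) (g : Fin q → CommutativeRing.Carrier R) →
    let open Setup R q n m src tgt s t g
        open CommutativeRing R using (_≈_)
    in ((a : ExpV) (b : VecE) → (∀ v → Sᵀ b v ≡ a v -q Tᵀ 𝟏E v) →
          coeff a Fq ≈ cosetEnum b)
       × (coeff (Tᵀ 𝟏E) Fq ≈ sumR (map weight kerSᵀ))
theorem5 R q _ n m src tgt s t g = coeff-Fq≈cosetEnum , coeff-Fq-Tᵀ𝟏≈weightEnum
  where open GraphPolynomial R q n s t g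
        open Coefficients m src tgt
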